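{- Suppose $\vec T$ satisfies Condition 1, 2 or 3 at each vertex of $H$, and satisfies Condition 2 at some vertex of $H$. Then for every $i\in\{1,\dots,2k\}$, the vertices $v_i$ and $w_i$ lie in the same connected component of $K$, and that component also contains some vertex of $K$ at which Condition 2 is satisfied.
   Context: $H$ is a connected finite simple graph with no leaves, vertices $1,\dots,t$, $k$ edges, oriented arbitrarily with directed edges $\overrightarrow{a_1a_2},\dots,\overrightarrow{a_{2k-1}a_{2k}}$; $\Gamma(b)=\{i:a_i=b\}$. $G$ is a finite simple graph and $\vec G$ its symmetric digraph. $\vec T=(\vec T_1,\vec T_2)$ is a $2k$-tuple of edges of $\vec G$ with $\vec T_1=(\overrightarrow{v_1v_2},\dots,\overrightarrow{v_{2k-1}v_{2k}})$, $\vec T_2=(\overrightarrow{w_1w_2},\dots,\overrightarrow{w_{2k-1}w_{2k}})$. $K$ is the undirected subgraph of $G$ consisting of the edges $v_{2i-1}v_{2i}$ and $w_{2i-1}w_{2i}$. Conditions at a vertex $b$ of $H$: Condition 1: the $v_i$, $i\in\Gamma(b)$, are all equal and the $w_i$, $i\in\Gamma(b)$, are all equal. Condition 2: $v_i=w_i$ for all $i\in\Gamma(b)$. Condition 3: there are vertices $x,y$ of $G$ such that for every $i\in\Gamma(b)$, either ($v_i=x$, $w_i=y$) or ($v_i=y$, $w_i=x$). If $i\in\Gamma(b)$ and $\vec T$ satisfies a Condition at $b$, then $\vec T$ is said to satisfy that Condition at the vertices $v_i$ and $w_i$ of $K$. -}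

module Defs where

open import Data.Nat using (ℕ)
open import Data.Fin using (Fin; zero; suc)
open import Data.Product using (_×_; _,_; ∃; ∃-syntax; Σ-syntax)
open import Data.Sum using (_⊎_)
open import Data.Empty using (⊥)
open import Relation.Binary.PropositionalEquality using (_≡_; _≢_)
open import Relation.Binary.Construct.Closure.ReflexiveTransitive using (Star)

-- Index set {1,…,2k} of endpoint positions: (j , 0) stands for the index 2j-1
-- (tail of the j-th directed edge), (j , 1) for 2j (its head).
Idx : ℕ → Set
Idx k = Fin k × Fin 2

tl hd : ∀ {k} → Fin k → Idx k
tl j = j , zero
hd j = j , suc zero

EdgeRel : ∀ {k} {V : Set} → (Idx k → V) → V → V → Set
EdgeRel {k} e x y =
  ∃[ j ] ((x ≡ e (tl j) × y ≡ e (hd j)) ⊎ (x ≡ e (hd j) × y ≡ e (tl j)))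

-- The oriented graph H on vertices Fin t with k edges a(2j-1) → a(2j).

module _ {t k : ℕ} (a : Idx k → Fin t) where

  IsSimple : Set
  IsSimple =
    (∀ j → a (tl j) ≢ a (hd j)) ×
    (∀ j j' → (a (tl j) ≡ a (tl j') × a (hd j) ≡ a (hd j'))
            ⊎ (a (tl j) ≡ a (hd j') × a (hd j) ≡ a (tl j')) → j ≡ j')

  IsConnected : Set
  IsConnected = ∀ (b c : Fin t) → Star (EdgeRel a) b c

  NoLeaves : Set
  NoLeaves = ∀ (b : Fin t) (i : Idx k) → a i ≡ b → ∃[ i' ] (i' ≢ i × a i' ≡ b)

  Γ : Fin t → Idx k → Set
  Γ b i = a i ≡ b

record SimpleGraph : Set₁ where
  field
    n     : ℕ
    Adj   : Fin n → Fin n → Set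
    sym   : ∀ {x y} → Adj x y → Adj y x
    irrefl : ∀ {x} → Adj x x → ⊥
open SimpleGraph public

-- A 2k-tuple T = (T₁ , T₂) of directed edges of the symmetric digraph of G:
-- T₁ = (v₁v₂ , … , v₂ₖ₋₁v₂ₖ), T₂ = (w₁w₂ , … , w₂ₖ₋₁w₂ₖ).

record Tuple (G : SimpleGraph) (k : ℕ) : Set where
  field
    v    : Idx k → Fin (n G)
    w    : Idx k → Fin (n G)
    v-edge : ∀ j → Adj G (v (tl j)) (v (hd j))
    w-edge : ∀ j → Adj G (w (tl j)) (w (hd j))
open Tuple public

module _ {G : SimpleGraph} {t k : ℕ} (a : Idx k → Fin t) (T : Tuple G k) where

  KAdj : Fin (n G) → Fin (n G) → Set
  KAdj x y = EdgeRel (v T) x y ⊎ EdgeRel (w T) x y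

  SameComponentK : Fin (n G) → Fin (n G) → Set
  SameComponentK = Star KAdj

  VertexOfK : Fin (n G) → Set
  VertexOfK x = ∃[ i ] (x ≡ v T i ⊎ x ≡ w T i)

  Condition1 : Fin t → Set
  Condition1 b = ∀ i i' → Γ a b i → Γ a b i' → v T i ≡ v T i' × w T i ≡ w T i'

  Condition2 : Fin t → Set
  Condition2 b = ∀ i → Γ a b i → v T i ≡ w T i

  Condition3 : Fin t → Set
  Condition3 b = ∃[ x ] ∃[ y ] (∀ i → Γ a b i →
                   (v T i ≡ x × w T i ≡ y) ⊎ (v T i ≡ y × w T i ≡ x))

  Condition2AtK : Fin (n G) → Set
  Condition2AtK u = ∃[ b ] (Condition2 b × ∃[ i ] (Γ a b i × (u ≡ v T i ⊎ u ≡ w T i)))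

{-# OPTIONS --safe #-}
module Submission where

-- Call an endpoint index i resolved when v_i and w_i lie in one component of K
-- that contains a vertex at which Condition 2 holds.  All indices at a
-- Condition-2 vertex of H are resolved (v_i = w_i is itself such a vertex).
-- Along an edge j of H, v_{2j-1}v_{2j} and w_{2j-1}w_{2j} are edges of K, so
-- resolving one end of j resolves the other.  At a vertex satisfying
-- Condition 1 or 3 the pair {v_i , w_i} is the same for all i ∈ Γ(b) up to
-- order, so one resolved index resolves all of them.  Connectivity of H then
-- carries resolvedness from a Condition-2 vertex to every vertex.

open import Defs
open import Data.Nat using (ℕ)
open import Data.Fin using (Fin)
open import Data.Product using (_×_; ∃-syntax; _,_)
open import Data.Sum using (_⊎_; inj₁; inj₂)
open import Relation.Binary.PropositionalEquality as ≡ using (_≡_; refl; subst₂)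
open import Relation.Binary.Construct.Closure.ReflexiveTransitive
  using (Star; ε; _◅_; _◅◅_; reverse)

EdgeRel-sym : ∀ {k} {V : Set} (e : Idx k → V) {x y : V} → EdgeRel e x y → EdgeRel e y x
EdgeRel-sym e (j , inj₁ (p , q)) = j , inj₂ (q , p)
EdgeRel-sym e (j , inj₂ (p , q)) = j , inj₁ (q , p)

EdgeRel-tl-hd : ∀ {k} {V : Set} (e : Idx k → V) (j : Fin k) → EdgeRel e (e (tl j)) (e (hd j))
EdgeRel-tl-hd e j = j , inj₁ (refl , refl)

module _ {t k : ℕ} (a : Idx k → Fin t) {G : SimpleGraph} (T : Tuple G k) where

  private
    V = Fin (n G)
    _∼_ : V → V → Set
    _∼_ = SameComponentK a T

  KAdj-sym : ∀ {x y} → KAdj a T x y → KAdj a T y x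
  KAdj-sym (inj₁ e) = inj₁ (EdgeRel-sym (v T) e)
  KAdj-sym (inj₂ e) = inj₂ (EdgeRel-sym (w T) e)

  SameComponentK-sym : ∀ {x y} → x ∼ y → y ∼ x
  SameComponentK-sym = reverse KAdj-sym

  Anchored : V → Set
  Anchored x = ∃[ u ] (VertexOfK a T u × Condition2AtK a T u × x ∼ u)

  anchored-backward : ∀ {x y} → x ∼ y → Anchored y → Anchored x
  anchored-backward x∼y (u , uK , u₂ , y∼u) = u , uK , u₂ , (x∼y ◅◅ y∼u)

  Linked : V → V → Set
  Linked x y = x ∼ y × Anchored x

  Linked-sym : ∀ {x y} → Linked x y → Linked y x
  Linked-sym (x∼y , x⚓) = y∼x , anchored-backward y∼x x⚓
    where y∼x = SameComponentK-sym x∼y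

  Resolved : Idx k → Set
  Resolved i = Linked (v T i) (w T i)

  ResolvedAt : Fin t → Set
  ResolvedAt b = ∀ i → Γ a b i → Resolved i

  condition2⇒resolvedAt : ∀ b → Condition2 a T b → ResolvedAt b
  condition2⇒resolvedAt b C₂ i i∈Γb =
    subst₂ _∼_ refl (C₂ i i∈Γb) ε ,
    (v T i , (i , inj₁ refl) , (b , C₂ , i , i∈Γb , inj₁ refl) , ε)

  resolved-across : ∀ {s o} → KAdj a T (v T o) (v T s) → KAdj a T (w T s) (w T o) →
                    Resolved s → Resolved o
  resolved-across vₒ~vₛ wₛ~wₒ (vₛ∼wₛ , vₛ⚓) =
    (vₒ~vₛ ◅ vₛ∼wₛ ◅◅ wₛ~wₒ ◅ ε) , anchored-backward (vₒ~vₛ ◅ ε) vₛ⚓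

  resolved-tl⇒hd : ∀ j → Resolved (tl j) → Resolved (hd j)
  resolved-tl⇒hd j = resolved-across (inj₁ (EdgeRel-sym (v T) (EdgeRel-tl-hd (v T) j)))
                                     (inj₂ (EdgeRel-tl-hd (w T) j))

  resolved-hd⇒tl : ∀ j → Resolved (hd j) → Resolved (tl j)
  resolved-hd⇒tl j = resolved-across (inj₁ (EdgeRel-tl-hd (v T) j))
                                     (inj₂ (EdgeRel-sym (w T) (EdgeRel-tl-hd (w T) j)))

  condition1-spreads : ∀ {b o} → Condition1 a T b → Γ a b o → Resolved o → ResolvedAt b
  condition1-spreads {o = o} C₁ o∈Γb o✓ i i∈Γb with C₁ o i o∈Γb i∈Γb
  ... | vₒ≡vᵢ , wₒ≡wᵢ = subst₂ Linked vₒ≡vᵢ wₒ≡wᵢ o✓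

  condition3-spreads : ∀ {b o} → Condition3 a T b → Γ a b o → Resolved o → ResolvedAt b
  condition3-spreads {o = o} (x , y , C₃) o∈Γb o✓ i i∈Γb =
    orient (C₃ i i∈Γb) (xy-linked (C₃ o o∈Γb))
    where
      orient : ∀ {p q} → (p ≡ x × q ≡ y) ⊎ (p ≡ y × q ≡ x) → Linked x y → Linked p q
      orient (inj₁ (refl , refl)) xy = xy
      orient (inj₂ (refl , refl)) xy = Linked-sym xy

      xy-linked : (v T o ≡ x × w T o ≡ y) ⊎ (v T o ≡ y × w T o ≡ x) → Linked x y
      xy-linked (inj₁ (vₒ≡x , wₒ≡y)) = subst₂ Linked vₒ≡x wₒ≡y o✓
      xy-linked (inj₂ (vₒ≡y , wₒ≡x)) = Linked-sym (subst₂ Linked vₒ≡y wₒ≡x o✓)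

  resolved-spreads : ∀ {b o} → Condition1 a T b ⊎ Condition2 a T b ⊎ Condition3 a T b →
                     Γ a b o → Resolved o → ResolvedAt b
  resolved-spreads     (inj₁ C₁)               = condition1-spreads C₁
  resolved-spreads {b} (inj₂ (inj₁ C₂)) _ _       = condition2⇒resolvedAt b C₂
  resolved-spreads     (inj₂ (inj₂ C₃))           = condition3-spreads C₃

  module _ (cond : ∀ b → Condition1 a T b ⊎ Condition2 a T b ⊎ Condition3 a T b) where

    resolvedAt-edge : ∀ {b c} → ResolvedAt b → EdgeRel a b c → ResolvedAt c
    resolvedAt-edge {c = c} b✓ (j , inj₁ (b≡tl , c≡hd)) =
      resolved-spreads (cond c) (≡.sym c≡hd) (resolved-tl⇒hd j (b✓ (tl j) (≡.sym b≡tl)))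
    resolvedAt-edge {c = c} b✓ (j , inj₂ (b≡hd , c≡tl)) =
      resolved-spreads (cond c) (≡.sym c≡tl) (resolved-hd⇒tl j (b✓ (hd j) (≡.sym b≡hd)))

    resolvedAt-path : ∀ {b c} → ResolvedAt b → Star (EdgeRel a) b c → ResolvedAt c
    resolvedAt-path b✓ ε          = b✓
    resolvedAt-path b✓ (e ◅ path) = resolvedAt-path (resolvedAt-edge b✓ e) path

lemma3p6 : {t k : ℕ} (a : Idx k → Fin t) →
    IsSimple a → IsConnected a → NoLeaves a →
    (G : SimpleGraph) (T : Tuple G k) →
    (∀ (b : Fin t) → Condition1 a T b ⊎ Condition2 a T b ⊎ Condition3 a T b) →
    ∃[ b ] Condition2 a T b →
    ∀ (i : Idx k) →
      SameComponentK a T (v T i) (w T i) ×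
      ∃[ u ] (VertexOfK a T u × Condition2AtK a T u × SameComponentK a T (v T i) u)
lemma3p6 a _ connected _ G T cond (b , C₂) i =
  resolvedAt-path a T cond (condition2⇒resolvedAt a T b C₂) (connected b (a i)) i refl
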